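{- Let $m\geq 3$ be an odd integer and let $p$, $p+2$ be a pair of twin primes. Then either neither of $\pm 2^{\frac{p-1}{2}}(1+\sqrt{1-2m^p})$ is a $p$-th power of an element of the ring of integers of $\mathbb{Q}(\sqrt{1-2m^p})$, or neither of $\pm 2^{\frac{p+1}{2}}(1+\sqrt{1-2m^{p+2}})$ is a $(p+2)$-th power of an element of the ring of integers of $\mathbb{Q}(\sqrt{1-2m^{p+2}})$. -}

module Defs where

open import Data.Nat as ℕ using (ℕ; zero; suc)
open import Data.Integer as ℤ using (ℤ; +_)
open import Data.Rational as ℚ using (ℚ; 0ℚ; 1ℚ)
open import Data.List using (List; []; _∷_; length)
open import Data.Product using (_×_; _,_; Σ; ∃)
open import Relation.Binary.PropositionalEquality using (_≡_)
open import Relation.Nullary using (¬_)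

-- Elements x + y·√d of ℚ(√d) (d a non-square integer), represented by the
-- pair (x , y) of rationals.
QSqrt : ℤ → Set
QSqrt d = ℚ × ℚ

module _ (d : ℤ) where
  fromℚ : ℚ → QSqrt d
  fromℚ x = x , 0ℚ

  fromℤ : ℤ → QSqrt d
  fromℤ z = fromℚ (z ℚ./ 1)

  add : QSqrt d → QSqrt d → QSqrt d
  add (a , b) (c , e) = a ℚ.+ c , b ℚ.+ e

  neg : QSqrt d → QSqrt d
  neg (a , b) = ℚ.- a , ℚ.- b

  -- (a + b√d)(c + e√d) = (ac + d·be) + (ae + bc)√d
  mul : QSqrt d → QSqrt d → QSqrt d
  mul (a , b) (c , e) = a ℚ.* c ℚ.+ (d ℚ./ 1) ℚ.* (b ℚ.* e) , a ℚ.* e ℚ.+ b ℚ.* c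

  pow : QSqrt d → ℕ → QSqrt d
  pow α zero    = fromℚ 1ℚ
  pow α (suc n) = mul α (pow α n)

  -- Evaluate the monic polynomial X^(length cs) + Σ_i cs[i] X^i at α
  -- (cs lists the lower coefficients c₀, c₁, …).
  evalLower : List ℤ → QSqrt d → ℕ → QSqrt d
  evalLower []       α i = fromℚ 0ℚ
  evalLower (c ∷ cs) α i = add (mul (fromℤ c) (pow α i)) (evalLower cs α (suc i))

  evalMonic : List ℤ → QSqrt d → QSqrt d
  evalMonic cs α = add (pow α (length cs)) (evalLower cs α 0)

  InRingOfIntegers : QSqrt d → Set
  InRingOfIntegers α = ∃ λ (cs : List ℤ) → evalMonic cs α ≡ fromℚ 0ℚ

  IsPowerInOK : ℕ → QSqrt d → Set
  IsPowerInOK n γ = ∃ λ (β : QSqrt d) → InRingOfIntegers β × pow β n ≡ γ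

discr : ℕ → ℕ → ℤ
discr m n = + 1 ℤ.- + (2 ℕ.* m ℕ.^ n)

twoPowOnePlusSqrt : (d : ℤ) → ℕ → QSqrt d
twoPowOnePlusSqrt d k = (+ (2 ℕ.^ k) ℚ./ 1) , (+ (2 ℕ.^ k) ℚ./ 1)

NeitherIsPower : ℕ → ℕ → ℕ → Set
NeitherIsPower m n k =
  ¬ IsPowerInOK (discr m n) n (twoPowOnePlusSqrt (discr m n) k) ×
  ¬ IsPowerInOK (discr m n) n (neg (discr m n) (twoPowOnePlusSqrt (discr m n) k))

-- Let n = 2k + 1, D = 1 - 2mⁿ, and suppose βⁿ = C(1 + √D) with |C| = 2ᵏ for some
-- β = a + b√D in ℚ(√D). Taking norms, N(β)ⁿ = C²(1 - D) = (2m)ⁿ, so N(β) = 2m as n is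
-- odd. Write a = r/s in lowest terms and w = r² - 2ms² = s²Db². Then sβ = r + sb√D,
-- and expanding (r + √w)ⁿ = P + Q√w gives P = sⁿC and D(sⁿC)² = wQ². Since
-- P ≡ 2ⁿ⁻¹rⁿ modulo s, and even modulo 2ⁿ when s is even, this forces s = 1. Then
-- P = C is divisible by r, and by 2ᵏ⁺¹ if r is even, so r = ±1. Now w = 1 - 2m and
-- 4ᵏ(2mⁿ - 1) = (2m - 1)Q², so 2m - 1 divides ((2m)ⁿ - 1) - 4ᵏ(2mⁿ - 1) = 4ᵏ - 1.
-- For the twin primes p = 2k + 1 and p + 2 this cannot happen for both k and k + 1,
-- since then 2m - 1 ≥ 5 would divide 4(4ᵏ - 1) - (4ᵏ⁺¹ - 1) = -3.

module Submission where

open import Data.Nat as ℕ using (ℕ; zero; suc)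
import Data.Nat.Properties as ℕ
open import Data.Nat.Divisibility as ℕ using ()
import Data.Nat.DivMod as ℕ
open import Data.Nat.Coprimality as ℕ using (Coprime)
open import Data.Nat.Primality
  using (Prime; composite; prime[2]; ¬prime[0]; ¬prime[1]; composite⇒¬prime; prime⇒irreducible; euclidsLemma)
open import Data.Product using (∃; _×_; _,_; proj₁; proj₂)
open import Data.Sum as Sum using (_⊎_; inj₁; inj₂)
open import Data.Empty using (⊥-elim)
open import Relation.Nullary using (¬_; yes; no)
open import Relation.Binary.PropositionalEquality
open import Relation.Binary.Definitions using (tri<; tri≈; tri>)
open import Defs

coprime-* : ∀ {a b c} → Coprime a b → Coprime a c → Coprime a (b ℕ.* c)
coprime-* a⊥b a⊥c (d∣a , d∣bc) =
  a⊥c (d∣a , ℕ.coprime-divisor (λ (e∣d , e∣b) → a⊥b (ℕ.∣-trans e∣d d∣a , e∣b)) d∣bc)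

coprime-^ : ∀ {a b} n → Coprime a b → Coprime a (b ℕ.^ n)
coprime-^ zero    _   (_ , d∣1) = ℕ.∣1⇒≡1 d∣1
coprime-^ (suc n) a⊥b = coprime-* a⊥b (coprime-^ n a⊥b)

prime∤⇒coprime : ∀ {p a} → Prime p → ¬ p ℕ.∣ a → Coprime p a
prime∤⇒coprime p-prime p∤a (d∣p , d∣a) with prime⇒irreducible p-prime d∣p
... | inj₁ d≡1  = d≡1
... | inj₂ refl = ⊥-elim (p∤a d∣a)

prime∣^⇒∣ : ∀ {p} a n → Prime p → p ℕ.∣ a ℕ.^ n → p ℕ.∣ a
prime∣^⇒∣ a zero p-prime p∣1 with ℕ.∣1⇒≡1 p∣1
... | refl = ⊥-elim (¬prime[1] p-prime)
prime∣^⇒∣ a (suc n) p-prime p∣aⁿ⁺¹ with euclidsLemma a (a ℕ.^ n) p-prime p∣aⁿ⁺¹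
... | inj₁ p∣a  = p∣a
... | inj₂ p∣aⁿ = prime∣^⇒∣ a n p-prime p∣aⁿ

^-injectiveˡ : ∀ n {a b} → a ℕ.^ suc n ≡ b ℕ.^ suc n → a ≡ b
^-injectiveˡ n {a} {b} aⁿ⁺¹≡bⁿ⁺¹ with ℕ.<-cmp a b
... | tri< a<b _ _ = ⊥-elim (ℕ.<-irrefl aⁿ⁺¹≡bⁿ⁺¹ (ℕ.^-monoˡ-< (suc n) a<b))
... | tri≈ _ a≡b _ = a≡b
... | tri> _ _ b<a = ⊥-elim (ℕ.<-irrefl (sym aⁿ⁺¹≡bⁿ⁺¹) (ℕ.^-monoˡ-< (suc n) b<a))

module Integral where
  open import Data.Integer using (ℤ; +_; -[1+_]; 0ℤ; 1ℤ; _+_; _*_; _-_; -_; _^_; ∣_∣)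
  import Data.Integer.Properties as ℤ
  open import Data.Integer.Divisibility.Signed
  open import Data.Integer.Tactic.RingSolver using (solve-∀)

  pos-^ : ∀ a n → (+ a) ^ n ≡ + (a ℕ.^ n)
  pos-^ a zero    = refl
  pos-^ a (suc n) = trans (cong (+ a *_) (pos-^ a n)) (sym (ℤ.pos-* a (a ℕ.^ n)))

  abs-^ : ∀ x n → ∣ x ^ n ∣ ≡ ∣ x ∣ ℕ.^ n
  abs-^ x zero    = refl
  abs-^ x (suc n) = trans (ℤ.abs-* x (x ^ n)) (cong (∣ x ∣ ℕ.*_) (abs-^ x n))

  ^-distribʳ-* : ∀ x y n → (x * y) ^ n ≡ x ^ n * y ^ n
  ^-distribʳ-* x y zero    = refl
  ^-distribʳ-* x y (suc n) = trans (cong (x * y *_) (^-distribʳ-* x y n)) (interchange x y (x ^ n) (y ^ n))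
    where
    interchange : ∀ a b c d → a * b * (c * d) ≡ a * c * (b * d)
    interchange = solve-∀

  i*i≡∣i∣*∣i∣ : ∀ i → i * i ≡ + (∣ i ∣ ℕ.* ∣ i ∣)
  i*i≡∣i∣*∣i∣ (+ n)    = sym (ℤ.pos-* n n)
  i*i≡∣i∣*∣i∣ -[1+ n ] = refl

  ∣i∣≡2ᵏ⇒i²≡4ᵏ : ∀ i k → ∣ i ∣ ≡ 2 ℕ.^ k → i * i ≡ (+ 4) ^ k
  ∣i∣≡2ᵏ⇒i²≡4ᵏ i k ∣i∣≡2ᵏ = begin
    i * i                           ≡⟨ i*i≡∣i∣*∣i∣ i ⟩
    + (∣ i ∣ ℕ.* ∣ i ∣)             ≡⟨ cong (λ x → + (x ℕ.* x)) ∣i∣≡2ᵏ ⟩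
    + (2 ℕ.^ k ℕ.* 2 ℕ.^ k)         ≡⟨ ℤ.pos-* (2 ℕ.^ k) (2 ℕ.^ k) ⟩
    + (2 ℕ.^ k) * + (2 ℕ.^ k)       ≡⟨ cong₂ _*_ (sym (pos-^ 2 k)) (sym (pos-^ 2 k)) ⟩
    (+ 2) ^ k * (+ 2) ^ k           ≡⟨ sym (^-distribʳ-* (+ 2) (+ 2) k) ⟩
    (+ 4) ^ k                       ∎
    where open ≡-Reasoning

  [2x]²ᵏ⁺¹≡2·4ᵏ·x²ᵏ⁺¹ : ∀ x k → (+ 2 * x) ^ suc (k ℕ.* 2) ≡ + 2 * (+ 4) ^ k * x ^ suc (k ℕ.* 2)
  [2x]²ᵏ⁺¹≡2·4ᵏ·x²ᵏ⁺¹ x k = begin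
    (+ 2 * x) ^ n                   ≡⟨ ^-distribʳ-* (+ 2) x n ⟩
    + 2 * (+ 2) ^ (k ℕ.* 2) * x ^ n ≡⟨ cong (λ e → + 2 * (+ 2) ^ e * x ^ n) (ℕ.*-comm k 2) ⟩
    + 2 * (+ 2) ^ (2 ℕ.* k) * x ^ n ≡⟨ cong (λ y → + 2 * y * x ^ n) (sym (ℤ.^-*-assoc (+ 2) 2 k)) ⟩
    + 2 * (+ 4) ^ k * x ^ n         ∎
    where
    open ≡-Reasoning
    n = suc (k ℕ.* 2)

  discr≡1-2mⁿ : ∀ m n → discr m n ≡ + 1 - + 2 * (+ m) ^ n
  discr≡1-2mⁿ m n = cong (λ x → + 1 - x) (trans (ℤ.pos-* 2 (m ℕ.^ n)) (cong (+ 2 *_) (sym (pos-^ m n))))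

  C²-discr·C²≡[2m]ⁿ : ∀ m k C → ∣ C ∣ ≡ 2 ℕ.^ k →
    C * C - discr m (suc (k ℕ.* 2)) * (C * C) ≡ (+ (2 ℕ.* m)) ^ suc (k ℕ.* 2)
  C²-discr·C²≡[2m]ⁿ m k C ∣C∣≡2ᵏ = begin
    C * C - discr m n * (C * C)
      ≡⟨ cong₂ (λ x y → y - x * y) (discr≡1-2mⁿ m n) (∣i∣≡2ᵏ⇒i²≡4ᵏ C k ∣C∣≡2ᵏ) ⟩
    A - (+ 1 - + 2 * (+ m) ^ n) * A         ≡⟨ expand A ((+ m) ^ n) ⟩
    + 2 * A * (+ m) ^ n                     ≡⟨ sym ([2x]²ᵏ⁺¹≡2·4ᵏ·x²ᵏ⁺¹ (+ m) k) ⟩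
    (+ 2 * + m) ^ n                         ≡⟨ cong (_^ n) (sym (ℤ.pos-* 2 m)) ⟩
    (+ (2 ℕ.* m)) ^ n                       ∎
    where
    open ≡-Reasoning
    n = suc (k ℕ.* 2)
    A = (+ 4) ^ k
    expand : ∀ A M → A - (+ 1 - + 2 * M) * A ≡ + 2 * A * M
    expand = solve-∀

  neg-^-odd : ∀ x k → (- x) ^ suc (k ℕ.* 2) ≡ - (x ^ suc (k ℕ.* 2))
  neg-^-odd x zero    = neg-^1 x
    where
    neg-^1 : ∀ x → - x * + 1 ≡ - (x * + 1)
    neg-^1 = solve-∀
  neg-^-odd x (suc k) = trans (cong (λ y → - x * (- x * y)) (neg-^-odd x k)) (neg-^2 x (x ^ suc (k ℕ.* 2)))
    where
    neg-^2 : ∀ x y → - x * (- x * - y) ≡ - (x * (x * y))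
    neg-^2 = solve-∀

  ^-odd-injective : ∀ x y k → x ^ suc (k ℕ.* 2) ≡ (+ y) ^ suc (k ℕ.* 2) → x ≡ + y
  ^-odd-injective (+ a) y k aⁿ≡yⁿ =
    cong +_ (^-injectiveˡ (k ℕ.* 2) (ℤ.+-injective (trans (sym (pos-^ a n)) (trans aⁿ≡yⁿ (pos-^ y n)))))
    where
    n = suc (k ℕ.* 2)
  ^-odd-injective -[1+ a ] y k -[1+a]ⁿ≡yⁿ =
    ⊥-elim (negative≢positive (ℕ.m^n>0 (suc a) n) (trans (sym -[1+a]ⁿ≡-[1+aⁿ]) (trans -[1+a]ⁿ≡yⁿ (pos-^ y n))))
    where
    n = suc (k ℕ.* 2)
    -[1+a]ⁿ≡-[1+aⁿ] : -[1+ a ] ^ n ≡ - + (suc a ℕ.^ n)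
    -[1+a]ⁿ≡-[1+aⁿ] = trans (neg-^-odd (+ suc a) k) (cong -_ (pos-^ (suc a) n))
    negative≢positive : ∀ {u v} → 0 ℕ.< u → - + u ≢ + v
    negative≢positive {suc u} _ ()

  ∣0 : ∀ {t} → t ∣ 0ℤ
  ∣0 = divides 0ℤ refl

  ∣m∣m-n⇒∣n : ∀ {t m n} → t ∣ m → t ∣ m - n → t ∣ n
  ∣m∣m-n⇒∣n {m = m} {n} t∣m t∣m-n = subst (_ ∣_) (m-[m-n]≡n m n) (∣m∣n⇒∣m-n t∣m t∣m-n)
    where
    m-[m-n]≡n : ∀ m n → m - (m - n) ≡ n
    m-[m-n]≡n = solve-∀

  *-pres-∣ : ∀ {a b x y} → a ∣ x → b ∣ y → a * b ∣ x * y
  *-pres-∣ {b = b} {x = x} a∣x b∣y = ∣-trans (*-monoˡ-∣ b a∣x) (*-monoʳ-∣ x b∣y)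

  ^-mono-∣ : ∀ {a b} n → a ∣ b → a ^ n ∣ b ^ n
  ^-mono-∣ zero    _   = ∣-refl
  ^-mono-∣ (suc n) a∣b = *-pres-∣ a∣b (^-mono-∣ n a∣b)

  x-1∣xⁿ-1 : ∀ x n → x - + 1 ∣ x ^ n - + 1
  x-1∣xⁿ-1 x zero    = subst (x - + 1 ∣_) (sym (ℤ.+-inverseʳ (+ 1))) ∣0
  x-1∣xⁿ-1 x (suc n) = subst (_ ∣_) (telescope x (x ^ n)) (∣m∣n⇒∣m+n (∣n⇒∣m*n x (x-1∣xⁿ-1 x n)) ∣-refl)
    where
    telescope : ∀ x y → x * (y - + 1) + (x - + 1) ≡ x * y - + 1
    telescope = solve-∀

  -- (r + √w)ⁱ = P r w i + Q r w i · √w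
  P Q : ℤ → ℤ → ℕ → ℤ
  P r w zero    = 1ℤ
  P r w (suc i) = r * P r w i + w * Q r w i
  Q r w zero    = 0ℤ
  Q r w (suc i) = P r w i + r * Q r w i

  P≡2ⁱr¹⁺ⁱ-mod : ∀ r {w t} → t ∣ w - r * r → ∀ i →
    (t ∣ P r w (suc i) - (+ 2) ^ i * r ^ suc i) × (t ∣ Q r w (suc i) - (+ 2) ^ i * r ^ i)
  P≡2ⁱr¹⁺ⁱ-mod r {w} {t} _ zero = subst (t ∣_) (sym (P₁ r w)) ∣0 , subst (t ∣_) (sym (Q₁ r)) ∣0
    where
    P₁ : ∀ r w → (r * + 1 + w * + 0) - + 1 * (r * + 1) ≡ + 0
    P₁ = solve-∀
    Q₁ : ∀ r → (+ 1 + r * + 0) - + 1 * + 1 ≡ + 0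
    Q₁ = solve-∀
  P≡2ⁱr¹⁺ⁱ-mod r {w} {t} t∣w-r² (suc i) with P≡2ⁱr¹⁺ⁱ-mod r t∣w-r² i
  ... | t∣P-2ⁱr¹⁺ⁱ , t∣Q-2ⁱrⁱ =
      subst (t ∣_) (sym (P-step r w (P r w (suc i)) (Q r w (suc i)) ((+ 2) ^ i) (r ^ i)))
        (∣m∣n⇒∣m+n (∣m∣n⇒∣m+n (∣n⇒∣m*n r t∣P-2ⁱr¹⁺ⁱ) (∣n⇒∣m*n w t∣Q-2ⁱrⁱ))
                   (∣n⇒∣m*n ((+ 2) ^ i * r ^ i) t∣w-r²))
    , subst (t ∣_) (sym (Q-step r (P r w (suc i)) (Q r w (suc i)) ((+ 2) ^ i) (r ^ i)))
        (∣m∣n⇒∣m+n t∣P-2ⁱr¹⁺ⁱ (∣n⇒∣m*n r t∣Q-2ⁱrⁱ))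
    where
    P-step : ∀ r w p q a ρ → (r * p + w * q) - (+ 2 * a) * (r * (r * ρ))
           ≡ r * (p - a * (r * ρ)) + w * (q - a * ρ) + a * ρ * (w - r * r)
    P-step = solve-∀
    Q-step : ∀ r p q a ρ → (p + r * q) - (+ 2 * a) * (r * ρ) ≡ (p - a * (r * ρ)) + r * (q - a * ρ)
    Q-step = solve-∀

  r∣P[odd] : ∀ r w j → r ∣ P r w (suc (j ℕ.* 2))
  r∣P[odd] r w = r∣P[1+even]
    where
    r∣Q[even] : ∀ j → r ∣ Q r w (j ℕ.* 2)
    r∣P[1+even] : ∀ j → r ∣ P r w (suc (j ℕ.* 2))
    r∣Q[even] zero    = ∣0
    r∣Q[even] (suc j) = ∣m∣n⇒∣m+n (r∣P[1+even] j) (∣m⇒∣m*n _ ∣-refl)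
    r∣P[1+even] j = ∣m∣n⇒∣m+n (∣m⇒∣m*n _ ∣-refl) (∣n⇒∣m*n w (r∣Q[even] j))

  2ʲ⁺¹∣P[2j+1] : ∀ {r w} → + 2 ∣ r → + 2 ∣ w → ∀ j → (+ 2) ^ suc j ∣ P r w (suc (j ℕ.* 2))
  2ʲ⁺¹∣P[2j+1] {r} {w} 2∣r 2∣w j = proj₁ (odd j)
    where
    even : ∀ j → ((+ 2) ^ j ∣ P r w (j ℕ.* 2)) × ((+ 2) ^ j ∣ Q r w (j ℕ.* 2))
    odd  : ∀ j → ((+ 2) ^ suc j ∣ P r w (suc (j ℕ.* 2))) × ((+ 2) ^ j ∣ Q r w (suc (j ℕ.* 2)))
    even zero = ∣-refl , ∣0
    even (suc j) with odd j
    ... | p , q = ∣m∣n⇒∣m+n (∣n⇒∣m*n r p) (*-pres-∣ 2∣w q) , ∣m∣n⇒∣m+n p (*-pres-∣ 2∣r q)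
    odd j with even j
    ... | p , q = ∣m∣n⇒∣m+n (*-pres-∣ 2∣r p) (*-pres-∣ 2∣w q) , ∣m∣n⇒∣m+n p (∣n⇒∣m*n r q)

  P≡2ⁱr¹⁺ⁱ-mod-2¹⁺ⁱ : ∀ r {w} v → w ≡ r * r + + 8 * v → ∀ i →
    (+ 2) ^ suc i ∣ P r w (suc i) - (+ 2) ^ i * r ^ suc i
  P≡2ⁱr¹⁺ⁱ-mod-2¹⁺ⁱ r v refl i =
    let s , q = invariant i in
    subst (_ ∣_) (sym (P-step r v (P r w i) (Q r w i) ((+ 2) ^ i) (r ^ i)))
      (∣m∣n⇒∣m+n (∣n⇒∣m*n r s) (∣n⇒∣m*n v (∣n⇒∣m*n (+ 2) (*-monoʳ-∣ (+ 2) q))))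
    where
    w = r * r + + 8 * v
    P-step : ∀ r v p q a ρ → (r * p + (r * r + + 8 * v) * q) - a * (r * ρ)
           ≡ r * ((p + r * q) - a * ρ) + v * (+ 2 * (+ 2 * (+ 2 * q)))
    P-step = solve-∀
    invariant : ∀ i → ((+ 2) ^ suc i ∣ (P r w i + r * Q r w i) - (+ 2) ^ i * r ^ i) × ((+ 2) ^ i ∣ + 2 * Q r w i)
    invariant zero = subst (_ ∣_) (sym (S₀ r)) ∣0 , ∣0
      where
      S₀ : ∀ r → (+ 1 + r * + 0) - + 1 * + 1 ≡ + 0
      S₀ = solve-∀
    invariant (suc i) =
      let s , q = invariant i in
      subst (_ ∣_) (sym (S-step r v (P r w i) (Q r w i) ((+ 2) ^ i) (r ^ i)))
        (∣m∣n⇒∣m+n (*-monoʳ-∣ (+ 2) (∣n⇒∣m*n r s)) (∣n⇒∣m*n v (*-monoʳ-∣ (+ 2) (*-monoʳ-∣ (+ 2) q))))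
      , subst (_ ∣_) (sym (Q-step r (P r w i) (Q r w i) ((+ 2) ^ i) (r ^ i)))
        (∣m∣n⇒∣m+n (∣n⇒∣m*n (+ 2) s) (∣m⇒∣m*n (r ^ i) ∣-refl))
      where
      S-step : ∀ r v p q a ρ → ((r * p + (r * r + + 8 * v) * q) + r * (p + r * q)) - (+ 2 * a) * (r * ρ)
             ≡ + 2 * (r * ((p + r * q) - a * ρ)) + v * (+ 2 * (+ 2 * (+ 2 * q)))
      S-step = solve-∀
      Q-step : ∀ r p q a ρ → + 2 * (p + r * q) ≡ + 2 * ((p + r * q) - a * ρ) + (+ 2 * a) * ρ
      Q-step = solve-∀

  ∣2ⁱrⁱ⁺¹∣ : ∀ r i → ∣ (+ 2) ^ i * r ^ suc i ∣ ≡ 2 ℕ.^ i ℕ.* ∣ r ∣ ℕ.^ suc i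
  ∣2ⁱrⁱ⁺¹∣ r i = trans (ℤ.abs-* ((+ 2) ^ i) (r ^ suc i)) (cong₂ ℕ._*_ (abs-^ (+ 2) i) (abs-^ r (suc i)))

  sⁱ⁺¹∣P⇒s≡1 : ∀ r {w} {s : ℕ} M i → Coprime ∣ r ∣ s →
    w ≡ r * r - + 2 * M * (+ s * + s) → (+ s) ^ suc i ∣ P r w (suc i) → s ≡ 1
  sⁱ⁺¹∣P⇒s≡1 r {w} {s} M i r⊥s refl sⁱ⁺¹∣P with 2 ℕ.∣? s
  ... | yes 2∣s@(ℕ.divides q s≡q*2) = ⊥-elim (2≢1 (r⊥s (2∣∣r∣ , 2∣s)))
    where
    2≢1 : 2 ≢ 1
    2≢1 ()
    s≡2q : + s ≡ + q * + 2
    s≡2q = trans (cong +_ s≡q*2) (ℤ.pos-* q 2)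
    w≡r²+8v : w ≡ r * r + + 8 * - (M * (+ q * + q))
    w≡r²+8v = trans (cong (λ x → r * r - + 2 * M * (x * x)) s≡2q) (expand r M (+ q))
      where
      expand : ∀ r M q → r * r - + 2 * M * (q * + 2 * (q * + 2)) ≡ r * r + + 8 * - (M * (q * q))
      expand = solve-∀
    2ⁱ⁺¹∣2ⁱrⁱ⁺¹ : (+ 2) ^ suc i ∣ (+ 2) ^ i * r ^ suc i
    2ⁱ⁺¹∣2ⁱrⁱ⁺¹ = ∣m∣m-n⇒∣n (∣-trans (^-mono-∣ (suc i) (divides (+ q) s≡2q)) sⁱ⁺¹∣P)
                            (P≡2ⁱr¹⁺ⁱ-mod-2¹⁺ⁱ r _ w≡r²+8v i)
    2∣∣r∣ : 2 ℕ.∣ ∣ r ∣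
    2∣∣r∣ = prime∣^⇒∣ ∣ r ∣ (suc i) prime[2] (ℕ.*-cancelʳ-∣ (2 ℕ.^ i) {{ℕ.m^n≢0 2 i}}
              (subst₂ ℕ._∣_ (abs-^ (+ 2) (suc i)) (trans (∣2ⁱrⁱ⁺¹∣ r i) (ℕ.*-comm (2 ℕ.^ i) _))
                 (∣⇒∣ᵤ {(+ 2) ^ suc i} 2ⁱ⁺¹∣2ⁱrⁱ⁺¹)))
  ... | no 2∤s = s⊥2ⁱrⁱ⁺¹ (ℕ.∣-refl , subst (s ℕ.∣_) (∣2ⁱrⁱ⁺¹∣ r i) (∣⇒∣ᵤ s∣2ⁱrⁱ⁺¹))
    where
    s∣w-r² : + s ∣ w - r * r
    s∣w-r² = divides (- (+ 2 * M * + s)) (collect r M (+ s))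
      where
      collect : ∀ r M s → (r * r - + 2 * M * (s * s)) - r * r ≡ - (+ 2 * M * s) * s
      collect = solve-∀
    s∣2ⁱrⁱ⁺¹ : + s ∣ (+ 2) ^ i * r ^ suc i
    s∣2ⁱrⁱ⁺¹ = ∣m∣m-n⇒∣n (∣-trans (∣m⇒∣m*n _ ∣-refl) sⁱ⁺¹∣P) (proj₁ (P≡2ⁱr¹⁺ⁱ-mod r s∣w-r² i))
    s⊥2ⁱrⁱ⁺¹ : Coprime s (2 ℕ.^ i ℕ.* ∣ r ∣ ℕ.^ suc i)
    s⊥2ⁱrⁱ⁺¹ = coprime-* (coprime-^ i (ℕ.sym (prime∤⇒coprime prime[2] 2∤s))) (coprime-^ (suc i) (ℕ.sym r⊥s))

  ∣P∣≡2ᵏ⇒∣r∣≡1 : ∀ r {w} M k → w ≡ r * r - + 2 * M →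
    ∣ P r w (suc (k ℕ.* 2)) ∣ ≡ 2 ℕ.^ k → ∣ r ∣ ≡ 1
  ∣P∣≡2ᵏ⇒∣r∣≡1 r M k refl ∣P∣≡2ᵏ with 2 ℕ.∣? ∣ r ∣
  ... | yes 2∣∣r∣ =
    ⊥-elim (ℕ.<⇒≱ (ℕ.^-monoʳ-< 2 (ℕ.s≤s (ℕ.s≤s ℕ.z≤n)) (ℕ.n<1+n k)) (ℕ.∣⇒≤ {{ℕ.m^n≢0 2 k}} 2ᵏ⁺¹∣2ᵏ))
    where
    2∣r : + 2 ∣ r
    2∣r = ∣ᵤ⇒∣ 2∣∣r∣
    2∣w : + 2 ∣ r * r - + 2 * M
    2∣w = ∣m∣n⇒∣m-n (∣n⇒∣m*n r 2∣r) (∣m⇒∣m*n M ∣-refl)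
    2ᵏ⁺¹∣2ᵏ : 2 ℕ.^ suc k ℕ.∣ 2 ℕ.^ k
    2ᵏ⁺¹∣2ᵏ = subst₂ ℕ._∣_ (abs-^ (+ 2) (suc k)) ∣P∣≡2ᵏ (∣⇒∣ᵤ (2ʲ⁺¹∣P[2j+1] 2∣r 2∣w k))
  ... | no 2∤∣r∣ = coprime-^ k (ℕ.sym (prime∤⇒coprime prime[2] 2∤∣r∣))
                     (ℕ.∣-refl , subst (∣ r ∣ ℕ.∣_) ∣P∣≡2ᵏ (∣⇒∣ᵤ (r∣P[odd] r _ k)))

  DC²≡[1-2m]Q²⇒2m-1∣4ᵏ-1 : ∀ m k C Q → ∣ C ∣ ≡ 2 ℕ.^ k →
    discr m (suc (k ℕ.* 2)) * (C * C) ≡ (+ 1 - + 2 * + m) * (Q * Q) →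
    + 2 * + m - + 1 ∣ (+ 4) ^ k - + 1
  DC²≡[1-2m]Q²⇒2m-1∣4ᵏ-1 m k C Q ∣C∣≡2ᵏ norm-eq =
    subst (_ ∣_) (telescope A M) (∣m∣n⇒∣m-n 2m-1∣[2m]ⁿ-1 2m-1∣A[2M-1])
    where
    n = suc (k ℕ.* 2)
    M = (+ m) ^ n
    A = (+ 4) ^ k
    2m-1∣[2m]ⁿ-1 : + 2 * + m - + 1 ∣ + 2 * A * M - + 1
    2m-1∣[2m]ⁿ-1 = subst (λ x → _ ∣ x - + 1) ([2x]²ᵏ⁺¹≡2·4ᵏ·x²ᵏ⁺¹ (+ m) k) (x-1∣xⁿ-1 (+ 2 * + m) n)
    2m-1∣A[2M-1] : + 2 * + m - + 1 ∣ A * (+ 2 * M - + 1)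
    2m-1∣A[2M-1] = divides (Q * Q) (begin
      A * (+ 2 * M - + 1)               ≡⟨ negate A M ⟩
      - ((+ 1 - + 2 * M) * A)
        ≡⟨ cong (λ x → - ((+ 1 - + 2 * M) * x)) (sym (∣i∣≡2ᵏ⇒i²≡4ᵏ C k ∣C∣≡2ᵏ)) ⟩
      - ((+ 1 - + 2 * M) * (C * C))     ≡⟨ cong (λ x → - (x * (C * C))) (sym (discr≡1-2mⁿ m n)) ⟩
      - (discr m n * (C * C))           ≡⟨ cong -_ norm-eq ⟩
      - ((+ 1 - + 2 * + m) * (Q * Q))   ≡⟨ sym (negate (Q * Q) (+ m)) ⟩
      Q * Q * (+ 2 * + m - + 1)         ∎)
      where
      open ≡-Reasoning
      negate : ∀ x y → x * (+ 2 * y - + 1) ≡ - ((+ 1 - + 2 * y) * x)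
      negate = solve-∀
    telescope : ∀ A M → (+ 2 * A * M - + 1) - A * (+ 2 * M - + 1) ≡ A - + 1
    telescope = solve-∀

  2m-1∣4ᵏ-1⇒2m-1∤4ᵏ⁺¹-1 : ∀ {m} k → 3 ℕ.≤ m →
    + 2 * + m - + 1 ∣ (+ 4) ^ k - + 1 → ¬ (+ 2 * + m - + 1 ∣ (+ 4) ^ suc k - + 1)
  2m-1∣4ᵏ-1⇒2m-1∤4ᵏ⁺¹-1 {suc (suc (suc m))} k (ℕ.s≤s (ℕ.s≤s (ℕ.s≤s _))) d∣4ᵏ-1 d∣4ᵏ⁺¹-1 =
    ℕ.<⇒≱ 3<∣d∣ (ℕ.∣⇒≤ (∣⇒∣ᵤ d∣-3))
    where
    d∣-3 : + 2 * + suc (suc (suc m)) - + 1 ∣ - + 3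
    d∣-3 = subst (_ ∣_) (difference ((+ 4) ^ k)) (∣m∣n⇒∣m-n (∣n⇒∣m*n (+ 4) d∣4ᵏ-1) d∣4ᵏ⁺¹-1)
      where
      difference : ∀ A → + 4 * (A - + 1) - (+ 4 * A - + 1) ≡ - + 3
      difference = solve-∀
    3<∣d∣ : 3 ℕ.< ∣ + 2 * + suc (suc (suc m)) - + 1 ∣
    3<∣d∣ = ℕ.s≤s (ℕ.s≤s (ℕ.≤-trans (ℕ.s≤s (ℕ.s≤s ℕ.z≤n)) (ℕ.m≤n+m _ m)))

  cleared⇒2m-1∣4ᵏ-1 : ∀ m k r {w} {s : ℕ} {C} → Coprime ∣ r ∣ s → ∣ C ∣ ≡ 2 ℕ.^ k →
    w ≡ r * r - + 2 * + m * (+ s * + s) →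
    P r w (suc (k ℕ.* 2)) ≡ (+ s) ^ suc (k ℕ.* 2) * C →
    discr m (suc (k ℕ.* 2)) * ((+ s) ^ suc (k ℕ.* 2) * C * ((+ s) ^ suc (k ℕ.* 2) * C))
      ≡ w * (Q r w (suc (k ℕ.* 2)) * Q r w (suc (k ℕ.* 2))) →
    + 2 * + m - + 1 ∣ (+ 4) ^ k - + 1
  cleared⇒2m-1∣4ᵏ-1 m k r {w} {s} {C} r⊥s ∣C∣≡2ᵏ w≡r²-2ms² P≡sⁿC norm-eq
    with sⁱ⁺¹∣P⇒s≡1 r (+ m) (k ℕ.* 2) r⊥s w≡r²-2ms² (divides C (trans P≡sⁿC (ℤ.*-comm _ C)))
  ... | refl = DC²≡[1-2m]Q²⇒2m-1∣4ᵏ-1 m k C (Q r w n) ∣C∣≡2ᵏ (begin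
    discr m n * (C * C)                 ≡⟨ cong (λ x → discr m n * (x * x)) (sym 1ⁿC≡C) ⟩
    discr m n * (1ⁿC * 1ⁿC)             ≡⟨ norm-eq ⟩
    w * (Q r w n * Q r w n)             ≡⟨ cong (_* (Q r w n * Q r w n)) w≡1-2m ⟩
    (+ 1 - + 2 * + m) * (Q r w n * Q r w n) ∎)
    where
    open ≡-Reasoning
    n = suc (k ℕ.* 2)
    1ⁿC = (+ 1) ^ n * C
    1ⁿC≡C : 1ⁿC ≡ C
    1ⁿC≡C = trans (cong (_* C) (ℤ.^-zeroˡ n)) (ℤ.*-identityˡ C)
    w≡r²-2m : w ≡ r * r - + 2 * + m
    w≡r²-2m = trans w≡r²-2ms² (cong (λ x → r * r - x) (ℤ.*-identityʳ (+ 2 * + m)))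
    ∣r∣≡1 : ∣ r ∣ ≡ 1
    ∣r∣≡1 = ∣P∣≡2ᵏ⇒∣r∣≡1 r (+ m) k w≡r²-2m (trans (cong ∣_∣ (trans P≡sⁿC 1ⁿC≡C)) ∣C∣≡2ᵏ)
    r²≡1 : r * r ≡ + 1
    r²≡1 = trans (i*i≡∣i∣*∣i∣ r) (cong (λ x → + (x ℕ.* x)) ∣r∣≡1)
    w≡1-2m : w ≡ + 1 - + 2 * + m
    w≡1-2m = trans w≡r²-2m (cong (_- + 2 * + m) r²≡1)

module Rational where
  open import Data.Integer as ℤ using (ℤ; +_; ∣_∣)
  import Data.Integer.Properties as ℤ
  open import Data.Integer.Divisibility.Signed using (_∣_; _∣?_)
  open import Data.Integer.Tactic.RingSolver using (solve-∀)
  open import Data.Rational using (ℚ; mkℚ; 0ℚ; 1ℚ; ↥_; ↧_; _+_; _*_; _-_; -_; _/_; toℚᵘ)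
  import Data.Rational.Properties as ℚ
  open import Data.Rational.Unnormalised using (mkℚᵘ; *≡*) renaming (_≃_ to _≃ᵘ_)
  import Data.Rational.Unnormalised.Properties as ℚᵘ
  open import Data.Rational.Solver using (module +-*-Solver)
  open +-*-Solver using (solve; _:=_; con; _:+_; _:*_; _:-_)
  open Integral using (P; Q; ^-odd-injective; C²-discr·C²≡[2m]ⁿ; cleared⇒2m-1∣4ᵏ-1; 2m-1∣4ᵏ-1⇒2m-1∤4ᵏ⁺¹-1)
  open ≡-Reasoning

  ι : ℤ → ℚ
  ι i = i / 1

  toℚᵘ-ι : ∀ i → toℚᵘ (ι i) ≃ᵘ mkℚᵘ i 0
  toℚᵘ-ι i = ℚ.toℚᵘ-fromℚᵘ (mkℚᵘ i 0)

  ι-+ : ∀ i j → ι (i ℤ.+ j) ≡ ι i + ι j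
  ι-+ i j = ℚ.toℚᵘ-injective (ℚᵘ.≃-trans (toℚᵘ-ι (i ℤ.+ j)) (ℚᵘ.≃-trans (*≡* (denominators i j))
    (ℚᵘ.≃-sym (ℚᵘ.≃-trans (ℚ.toℚᵘ-homo-+ (ι i) (ι j)) (ℚᵘ.+-cong (toℚᵘ-ι i) (toℚᵘ-ι j))))))
    where
    denominators : ∀ i j → (i ℤ.+ j) ℤ.* + 1 ≡ (i ℤ.* + 1 ℤ.+ j ℤ.* + 1) ℤ.* + 1
    denominators = solve-∀

  ι-* : ∀ i j → ι (i ℤ.* j) ≡ ι i * ι j
  ι-* i j = ℚ.toℚᵘ-injective (ℚᵘ.≃-trans (toℚᵘ-ι (i ℤ.* j)) (ℚᵘ.≃-sym
    (ℚᵘ.≃-trans (ℚ.toℚᵘ-homo-* (ι i) (ι j)) (ℚᵘ.*-cong (toℚᵘ-ι i) (toℚᵘ-ι j)))))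

  ι-*³ : ∀ a b c → ι (a ℤ.* (b ℤ.* c)) ≡ ι a * (ι b * ι c)
  ι-*³ a b c = trans (ι-* a (b ℤ.* c)) (cong (ι a *_) (ι-* b c))

  ι-neg : ∀ i → ι (ℤ.- i) ≡ - ι i
  ι-neg i = ℚ.toℚᵘ-injective (ℚᵘ.≃-trans (toℚᵘ-ι (ℤ.- i))
    (ℚᵘ.≃-sym (ℚᵘ.≃-trans (ℚ.toℚᵘ-homo‿- (ι i)) (ℚᵘ.-‿cong (toℚᵘ-ι i)))))

  ι-sub : ∀ i j → ι (i ℤ.- j) ≡ ι i - ι j
  ι-sub i j = trans (ι-+ i (ℤ.- j)) (cong (λ q → ι i + q) (ι-neg j))

  ι-injective : ∀ {i j} → ι i ≡ ι j → i ≡ j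
  ι-injective {i} {j} ιi≡ιj
    with ℚᵘ.≃-trans (ℚᵘ.≃-sym (toℚᵘ-ι i)) (ℚᵘ.≃-trans (ℚ.toℚᵘ-cong ιi≡ιj) (toℚᵘ-ι j))
  ... | *≡* i*1≡j*1 = trans (sym (ℤ.*-identityʳ i)) (trans i*1≡j*1 (ℤ.*-identityʳ j))

  ↧*≡↥ : ∀ x → ι (↧ x) * x ≡ ι (↥ x)
  ↧*≡↥ x@(mkℚ r d-1 _) = ℚ.toℚᵘ-injective (ℚᵘ.≃-trans (ℚ.toℚᵘ-homo-* (ι (↧ x)) x)
    (ℚᵘ.≃-trans (ℚᵘ.*-cong (toℚᵘ-ι (↧ x)) (ℚᵘ.≃-refl {mkℚᵘ r d-1}))
      (ℚᵘ.≃-trans (*≡* (trans (cross (+ suc d-1) r) (cong (λ e → r ℤ.* + suc e) (sym (ℕ.+-identityʳ d-1)))))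
        (ℚᵘ.≃-sym (toℚᵘ-ι r)))))
    where
    cross : ∀ s r → (s ℤ.* r) ℤ.* + 1 ≡ r ℤ.* s
    cross = solve-∀

  ↥≡c*↧⇒≡ι : ∀ x c → ↥ x ≡ c ℤ.* ↧ x → x ≡ ι c
  ↥≡c*↧⇒≡ι x@(mkℚ r _ _) c ↥x≡c↧x =
    ℚ.toℚᵘ-injective (ℚᵘ.≃-trans (*≡* (trans (ℤ.*-identityʳ r) ↥x≡c↧x)) (ℚᵘ.≃-sym (toℚᵘ-ι c)))

  infixr 8 _^_
  _^_ : ℚ → ℕ → ℚ
  x ^ zero  = 1ℚ
  x ^ suc n = x * x ^ n

  ι-^ : ∀ x i → ι (x ℤ.^ i) ≡ ι x ^ i
  ι-^ x zero    = refl
  ι-^ x (suc i) = trans (ι-* x (x ℤ.^ i)) (cong (ι x *_) (ι-^ x i))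

  ^-distribʳ-* : ∀ x y i → (x * y) ^ i ≡ x ^ i * y ^ i
  ^-distribʳ-* x y zero    = sym (ℚ.*-identityˡ 1ℚ)
  ^-distribʳ-* x y (suc i) = trans (cong (x * y *_) (^-distribʳ-* x y i)) (interchange x y (x ^ i) (y ^ i))
    where
    interchange : ∀ x y X Y → x * y * (X * Y) ≡ x * X * (y * Y)
    interchange = solve 4 (λ x y X Y → x :* y :* (X :* Y) := x :* X :* (y :* Y)) refl

  ^-odd-root : ∀ k x c → x ^ suc (k ℕ.* 2) ≡ ι (+ c) ^ suc (k ℕ.* 2) → x ≡ ι (+ c)
  ^-odd-root k x@(mkℚ r d-1 _) c xⁿ≡cⁿ =
    ↥≡c*↧⇒≡ι x (+ c) (trans r≡sc (trans (ℤ.pos-* s c) (ℤ.*-comm (+ s) (+ c))))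
    where
    n = suc (k ℕ.* 2)
    s = suc d-1
    sⁿcⁿ≡rⁿ : ι ((+ s) ℤ.^ n ℤ.* (+ c) ℤ.^ n) ≡ ι (r ℤ.^ n)
    sⁿcⁿ≡rⁿ = begin
      ι ((+ s) ℤ.^ n ℤ.* (+ c) ℤ.^ n)     ≡⟨ ι-* ((+ s) ℤ.^ n) ((+ c) ℤ.^ n) ⟩
      ι ((+ s) ℤ.^ n) * ι ((+ c) ℤ.^ n)   ≡⟨ cong₂ _*_ (ι-^ (+ s) n) (trans (ι-^ (+ c) n) (sym xⁿ≡cⁿ)) ⟩
      ι (+ s) ^ n * x ^ n                 ≡⟨ sym (^-distribʳ-* (ι (+ s)) x n) ⟩
      (ι (+ s) * x) ^ n                   ≡⟨ cong (_^ n) (↧*≡↥ x) ⟩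
      ι r ^ n                             ≡⟨ sym (ι-^ r n) ⟩
      ι (r ℤ.^ n)                         ∎
    r≡sc : r ≡ + (s ℕ.* c)
    r≡sc = ^-odd-injective r (s ℕ.* c) k (begin
      r ℤ.^ n                             ≡⟨ sym (ι-injective sⁿcⁿ≡rⁿ) ⟩
      (+ s) ℤ.^ n ℤ.* (+ c) ℤ.^ n         ≡⟨ sym (Integral.^-distribʳ-* (+ s) (+ c) n) ⟩
      (+ s ℤ.* + c) ℤ.^ n                 ≡⟨ cong (ℤ._^ n) (sym (ℤ.pos-* s c)) ⟩
      (+ (s ℕ.* c)) ℤ.^ n                 ∎)

  norm : (d : ℤ) → QSqrt d → ℚ
  norm d (x , y) = x * x - ι d * (y * y)

  norm-mul : ∀ d α β → norm d (mul d α β) ≡ norm d α * norm d β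
  norm-mul d (a , b) (c , e) = multiplicative a b c e (ι d)
    where
    multiplicative : ∀ a b c e d →
      (a * c + d * (b * e)) * (a * c + d * (b * e)) - d * ((a * e + b * c) * (a * e + b * c))
        ≡ (a * a - d * (b * b)) * (c * c - d * (e * e))
    multiplicative = solve 5 (λ a b c e d →
      (a :* c :+ d :* (b :* e)) :* (a :* c :+ d :* (b :* e)) :- d :* ((a :* e :+ b :* c) :* (a :* e :+ b :* c))
        := (a :* a :- d :* (b :* b)) :* (c :* c :- d :* (e :* e))) refl

  norm-pow : ∀ d α i → norm d (pow d α i) ≡ norm d α ^ i
  norm-pow d α zero    = norm-1 (ι d)
    where
    norm-1 : ∀ d → 1ℚ * 1ℚ - d * (0ℚ * 0ℚ) ≡ 1ℚ
    norm-1 = solve 1 (λ d → con 1ℚ :* con 1ℚ :- d :* (con 0ℚ :* con 0ℚ) := con 1ℚ) refl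
  norm-pow d α (suc i) = trans (norm-mul d α (pow d α i)) (cong (norm d α *_) (norm-pow d α i))

  norm-ι : ∀ d x y → norm d (ι x , ι y) ≡ ι (x ℤ.* x ℤ.- d ℤ.* (y ℤ.* y))
  norm-ι d x y = sym (begin
    ι (x ℤ.* x ℤ.- d ℤ.* (y ℤ.* y))       ≡⟨ ι-sub (x ℤ.* x) (d ℤ.* (y ℤ.* y)) ⟩
    ι (x ℤ.* x) - ι (d ℤ.* (y ℤ.* y))     ≡⟨ cong₂ _-_ (ι-* x x) (ι-*³ d y y) ⟩
    ι x * ι x - ι d * (ι y * ι y)         ∎)

  clear-denominators : ∀ d a b r w s → ι s * a ≡ ι r → ι s * ι s * (ι d * (b * b)) ≡ ι w → ∀ i →
    ι (s ℤ.^ i) * proj₁ (pow d (a , b) i) ≡ ι (P r w i) ×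
    ι (s ℤ.^ i) * proj₂ (pow d (a , b) i) ≡ ι s * b * ι (Q r w i)
  clear-denominators d a b r w s sa≡r s²db²≡w = coefficients
    where
    S = ι s
    X Y : ℕ → ℚ
    X i = proj₁ (pow d (a , b) i)
    Y i = proj₂ (pow d (a , b) i)
    coefficients : ∀ i → ι (s ℤ.^ i) * X i ≡ ι (P r w i) × ι (s ℤ.^ i) * Y i ≡ S * b * ι (Q r w i)
    coefficients zero = ℚ.*-identityˡ 1ℚ , Y₀ S b
      where
      Y₀ : ∀ S b → 1ℚ * 0ℚ ≡ S * b * 0ℚ
      Y₀ = solve 2 (λ S b → con 1ℚ :* con 0ℚ := S :* b :* con 0ℚ) refl
    coefficients (suc i) = X-step , Y-step
      where
      T = ι (s ℤ.^ i)
      ιP = ι (P r w i)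
      ιQ = ι (Q r w i)
      TX≡P = proj₁ (coefficients i)
      TY≡SbQ = proj₂ (coefficients i)
      X-step : ι (s ℤ.^ suc i) * X (suc i) ≡ ι (P r w (suc i))
      X-step = begin
        ι (s ℤ.* s ℤ.^ i) * (a * X i + ι d * (b * Y i))  ≡⟨ cong (_* (a * X i + ι d * (b * Y i))) (ι-* s (s ℤ.^ i)) ⟩
        S * T * (a * X i + ι d * (b * Y i))              ≡⟨ regroup S T a (X i) (ι d) b (Y i) ⟩
        S * a * (T * X i) + ι d * b * S * (T * Y i)
          ≡⟨ cong₂ (λ u v → u + ι d * b * S * v) (cong₂ _*_ sa≡r TX≡P) TY≡SbQ ⟩
        ι r * ιP + ι d * b * S * (S * b * ιQ)            ≡⟨ regroup′ (ι r) ιP (ι d) b S ιQ ⟩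
        ι r * ιP + S * S * (ι d * (b * b)) * ιQ          ≡⟨ cong (λ z → ι r * ιP + z * ιQ) s²db²≡w ⟩
        ι r * ιP + ι w * ιQ
          ≡⟨ sym (trans (ι-+ (r ℤ.* P r w i) (w ℤ.* Q r w i)) (cong₂ _+_ (ι-* r (P r w i)) (ι-* w (Q r w i)))) ⟩
        ι (P r w (suc i))                                ∎
        where
        regroup : ∀ S T a X d b Y → S * T * (a * X + d * (b * Y)) ≡ S * a * (T * X) + d * b * S * (T * Y)
        regroup = solve 7 (λ S T a X d b Y →
          S :* T :* (a :* X :+ d :* (b :* Y)) := S :* a :* (T :* X) :+ d :* b :* S :* (T :* Y)) refl
        regroup′ : ∀ r P d b S Q → r * P + d * b * S * (S * b * Q) ≡ r * P + S * S * (d * (b * b)) * Q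
        regroup′ = solve 6 (λ r P d b S Q →
          r :* P :+ d :* b :* S :* (S :* b :* Q) := r :* P :+ S :* S :* (d :* (b :* b)) :* Q) refl
      Y-step : ι (s ℤ.^ suc i) * Y (suc i) ≡ S * b * ι (Q r w (suc i))
      Y-step = begin
        ι (s ℤ.* s ℤ.^ i) * (a * Y i + b * X i)          ≡⟨ cong (_* (a * Y i + b * X i)) (ι-* s (s ℤ.^ i)) ⟩
        S * T * (a * Y i + b * X i)                      ≡⟨ regroup S T a (Y i) b (X i) ⟩
        S * a * (T * Y i) + S * b * (T * X i)            ≡⟨ cong₂ (λ u v → u + S * b * v) (cong₂ _*_ sa≡r TY≡SbQ) TX≡P ⟩
        ι r * (S * b * ιQ) + S * b * ιP                  ≡⟨ regroup′ (ι r) S b ιQ ιP ⟩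
        S * b * (ιP + ι r * ιQ)
          ≡⟨ cong (S * b *_) (sym (trans (ι-+ (P r w i) (r ℤ.* Q r w i)) (cong (λ z → ιP + z) (ι-* r (Q r w i))))) ⟩
        S * b * ι (Q r w (suc i))                        ∎
        where
        regroup : ∀ S T a Y b X → S * T * (a * Y + b * X) ≡ S * a * (T * Y) + S * b * (T * X)
        regroup = solve 6 (λ S T a Y b X →
          S :* T :* (a :* Y :+ b :* X) := S :* a :* (T :* Y) :+ S :* b :* (T :* X)) refl
        regroup′ : ∀ r S b Q P → r * (S * b * Q) + S * b * P ≡ S * b * (P + r * Q)
        regroup′ = solve 5 (λ r S b Q P → r :* (S :* b :* Q) :+ S :* b :* P := S :* b :* (P :+ r :* Q)) refl

  βⁿ≡C[1+√D]⇒2m-1∣4ᵏ-1 : ∀ m k C → ∣ C ∣ ≡ 2 ℕ.^ k → (β : QSqrt (discr m (suc (k ℕ.* 2)))) →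
    pow (discr m (suc (k ℕ.* 2))) β (suc (k ℕ.* 2)) ≡ (ι C , ι C) →
    + 2 ℤ.* + m ℤ.- + 1 ∣ (+ 4) ℤ.^ k ℤ.- + 1
  βⁿ≡C[1+√D]⇒2m-1∣4ᵏ-1 m k C ∣C∣≡2ᵏ β@(a@(mkℚ r d-1 r⊥s) , b) βⁿ≡γ =
    cleared⇒2m-1∣4ᵏ-1 m k r (ℕ.recompute r⊥s) ∣C∣≡2ᵏ refl P≡sⁿC D[sⁿC]²≡wQ²
    where
    n = suc (k ℕ.* 2)
    D = discr m n
    s = + suc d-1
    S = ι s
    2m = + 2 ℤ.* + m
    w = r ℤ.* r ℤ.- 2m ℤ.* (s ℤ.* s)
    N[β]≡2m : a * a - ι D * (b * b) ≡ ι 2m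
    N[β]≡2m = trans (^-odd-root k (norm D β) (2 ℕ.* m) (begin
      norm D β ^ n                         ≡⟨ sym (norm-pow D β n) ⟩
      norm D (pow D β n)                   ≡⟨ cong (norm D) βⁿ≡γ ⟩
      norm D (ι C , ι C)                   ≡⟨ norm-ι D C C ⟩
      ι (C ℤ.* C ℤ.- D ℤ.* (C ℤ.* C))      ≡⟨ cong ι (C²-discr·C²≡[2m]ⁿ m k C ∣C∣≡2ᵏ) ⟩
      ι ((+ (2 ℕ.* m)) ℤ.^ n)              ≡⟨ ι-^ (+ (2 ℕ.* m)) n ⟩
      ι (+ (2 ℕ.* m)) ^ n                  ∎)) (cong ι (ℤ.pos-* 2 m))
    S²Db²≡w : S * S * (ι D * (b * b)) ≡ ι w
    S²Db²≡w = begin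
      S * S * (ι D * (b * b))                       ≡⟨ complete-square S a (ι D) b ⟩
      S * a * (S * a) - (a * a - ι D * (b * b)) * (S * S)
        ≡⟨ cong₂ (λ u v → u * u - v * (S * S)) (↧*≡↥ a) N[β]≡2m ⟩
      ι r * ι r - ι 2m * (S * S)
        ≡⟨ norm-ι 2m r s ⟩
      ι w                                           ∎
      where
      complete-square : ∀ S a d b → S * S * (d * (b * b)) ≡ S * a * (S * a) - (a * a - d * (b * b)) * (S * S)
      complete-square = solve 4 (λ S a d b →
        S :* S :* (d :* (b :* b)) := S :* a :* (S :* a) :- (a :* a :- d :* (b :* b)) :* (S :* S)) refl
    sⁿ = ι (s ℤ.^ n)
    cleared = clear-denominators D a b r w s (↧*≡↥ a) S²Db²≡w n
    ι[sⁿC]≡ιP : ι (s ℤ.^ n ℤ.* C) ≡ ι (P r w n)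
    ι[sⁿC]≡ιP = trans (ι-* (s ℤ.^ n) C) (trans (cong (sⁿ *_) (sym (cong proj₁ βⁿ≡γ))) (proj₁ cleared))
    ι[sⁿC]≡SbQ : ι (s ℤ.^ n ℤ.* C) ≡ S * b * ι (Q r w n)
    ι[sⁿC]≡SbQ = trans (ι-* (s ℤ.^ n) C) (trans (cong (sⁿ *_) (sym (cong proj₂ βⁿ≡γ))) (proj₂ cleared))
    P≡sⁿC : P r w n ≡ s ℤ.^ n ℤ.* C
    P≡sⁿC = sym (ι-injective ι[sⁿC]≡ιP)
    D[sⁿC]²≡wQ² : D ℤ.* (s ℤ.^ n ℤ.* C ℤ.* (s ℤ.^ n ℤ.* C)) ≡ w ℤ.* (Q r w n ℤ.* Q r w n)
    D[sⁿC]²≡wQ² = ι-injective (begin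
      ι (D ℤ.* (T ℤ.* T))                  ≡⟨ ι-*³ D T T ⟩
      ι D * (ι T * ι T)                    ≡⟨ cong (λ z → ι D * (z * z)) ι[sⁿC]≡SbQ ⟩
      ι D * (S * b * ιQ * (S * b * ιQ))    ≡⟨ regroup (ι D) S b ιQ ⟩
      S * S * (ι D * (b * b)) * (ιQ * ιQ)  ≡⟨ cong (_* (ιQ * ιQ)) S²Db²≡w ⟩
      ι w * (ιQ * ιQ)                      ≡⟨ sym (ι-*³ w (Q r w n) (Q r w n)) ⟩
      ι (w ℤ.* (Q r w n ℤ.* Q r w n))      ∎)
      where
      T = s ℤ.^ n ℤ.* C
      ιQ = ι (Q r w n)
      regroup : ∀ d S b Q → d * (S * b * Q * (S * b * Q)) ≡ S * S * (d * (b * b)) * (Q * Q)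
      regroup = solve 4 (λ d S b Q → d :* (S :* b :* Q :* (S :* b :* Q)) := S :* S :* (d :* (b :* b)) :* (Q :* Q)) refl

  neither-is-power : ∀ m k → ¬ (+ 2 ℤ.* + m ℤ.- + 1 ∣ (+ 4) ℤ.^ k ℤ.- + 1) →
    NeitherIsPower m (suc (k ℕ.* 2)) k
  neither-is-power m k 2m-1∤4ᵏ-1 =
      (λ (β , _ , βⁿ≡γ) → 2m-1∤4ᵏ-1 (βⁿ≡C[1+√D]⇒2m-1∣4ᵏ-1 m k 2ᵏ refl β βⁿ≡γ))
    , (λ (β , _ , βⁿ≡-γ) → 2m-1∤4ᵏ-1 (βⁿ≡C[1+√D]⇒2m-1∣4ᵏ-1 m k (ℤ.- 2ᵏ) (ℤ.∣-i∣≡∣i∣ 2ᵏ) β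
          (trans βⁿ≡-γ (cong₂ _,_ (sym (ι-neg 2ᵏ)) (sym (ι-neg 2ᵏ))))))
    where
    2ᵏ = + (2 ℕ.^ k)

  neither-at-2k+1⊎neither-at-2k+3 : ∀ m k → 3 ℕ.≤ m →
    NeitherIsPower m (suc (k ℕ.* 2)) k ⊎ NeitherIsPower m (suc (suc k ℕ.* 2)) (suc k)
  neither-at-2k+1⊎neither-at-2k+3 m k 3≤m with + 2 ℤ.* + m ℤ.- + 1 ∣? (+ 4) ℤ.^ k ℤ.- + 1
  ... | no  2m-1∤4ᵏ-1 = inj₁ (neither-is-power m k 2m-1∤4ᵏ-1)
  ... | yes 2m-1∣4ᵏ-1 = inj₂ (neither-is-power m (suc k) (2m-1∣4ᵏ-1⇒2m-1∤4ᵏ⁺¹-1 k 3≤m 2m-1∣4ᵏ-1))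

parity : ∀ n → (∃ λ k → n ≡ k ℕ.* 2) ⊎ (∃ λ k → n ≡ suc (k ℕ.* 2))
parity zero = inj₁ (0 , refl)
parity (suc n) with parity n
... | inj₁ (k , refl) = inj₂ (k , refl)
... | inj₂ (k , refl) = inj₁ (suc k , refl)

twin-prime⇒odd : ∀ {p} → Prime p → Prime (p ℕ.+ 2) → ∃ λ k → p ≡ suc (k ℕ.* 2)
twin-prime⇒odd {p} p-prime p+2-prime with parity p
... | inj₂ p-odd = p-odd
... | inj₁ (zero , refl) = ⊥-elim (¬prime[0] p-prime)
... | inj₁ (suc k , refl) = ⊥-elim (composite⇒¬prime (composite 2<p+2 2∣p+2) p+2-prime)
  where
  2<p+2 : 2 ℕ.< suc k ℕ.* 2 ℕ.+ 2
  2<p+2 = ℕ.m<n+m 2 {suc k ℕ.* 2} (ℕ.s≤s ℕ.z≤n)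
  2∣p+2 : 2 ℕ.∣ suc k ℕ.* 2 ℕ.+ 2
  2∣p+2 = ℕ.divides (suc (suc k)) (ℕ.+-comm (suc k ℕ.* 2) 2)

[2k+1+1]/2≡1+k : ∀ k → (suc (k ℕ.* 2) ℕ.+ 1) ℕ./ 2 ≡ suc k
[2k+1+1]/2≡1+k k = trans (cong (λ x → suc x ℕ./ 2) (ℕ.+-comm (k ℕ.* 2) 1)) (ℕ.m*n/n≡m (suc k) 2)

open Rational using (neither-at-2k+1⊎neither-at-2k+3)

open import Data.Nat using (ℕ; _≤_; _+_; _∸_; _/_; _%_)
open import Data.Nat.Primality using (Prime)
open import Data.Sum using (_⊎_)
open import Relation.Binary.PropositionalEquality using (_≡_)

proposition23 : (m p : ℕ) → 3 ≤ m → m % 2 ≡ 1 → Prime p → Prime (p + 2) →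
    NeitherIsPower m p ((p ∸ 1) / 2) ⊎ NeitherIsPower m (p + 2) ((p + 1) / 2)
proposition23 m p 3≤m _ p-prime p+2-prime with twin-prime⇒odd p-prime p+2-prime
... | k , refl = Sum.map
  (subst (NeitherIsPower m p) (sym (ℕ.m*n/n≡m k 2)))
  (subst₂ (NeitherIsPower m) (cong suc (ℕ.+-comm 2 (k ℕ.* 2))) (sym ([2k+1+1]/2≡1+k k)))
  (neither-at-2k+1⊎neither-at-2k+3 m k 3≤m)
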